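{- Let $B$ be a square-to-square conveyor belt path in $\Gamma_5$ consisting of fewer than $150$ edges (i.e., fewer than $75$ successive $UD$ pairs). (a) If the starting vertex of $B$ is congruent to $1$ modulo $5$, then the endpoint of $B$ is at most $91^2$. (b) If the starting vertex of $B$ is congruent to $4$ modulo $5$, then the endpoint of $B$ is at most $183^2$.
   Context: Define sets of positive integers $R_1,R_2,\dots$ recursively: $R_1=\{2\}$; if $x\in R_k$ then $(x+5)^2\in R_{k+1}$; if $x^2\in R_k$ then $x\in R_{k+1}$. Let $S=\bigcup_i R_i$. The directed graph $\Gamma_5$ has vertex set $S$, up-edges $U$: $(n,(n+5)^2)$ for $n\in S$, and down-edges $D$: $(n^2,n)$ for $n\in S$. A conveyor belt is a path of the form $(UD)^i$, $i\ge1$ (so it goes $x\to(x+5)^2\to x+5\to (x+10)^2\to x+10\to\cdots\to x+5i$; its starting vertex is $x$ and its endpoint is $x+5i$). It is square-to-square if it both begins and ends at a perfect square. -}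

module Defs where

open import Data.Nat using (ℕ; zero; suc; _+_; _*_)
open import Data.Product using (Σ; _×_)
open import Relation.Binary.PropositionalEquality using (_≡_)

-- Membership in S = ⋃ R_k, given inductively by the three recursive rules.
data InS : ℕ → Set where
  base : InS 2
  up   : ∀ {x} → InS x → InS ((x + 5) * (x + 5))
  down : ∀ {x} → InS (x * x) → InS x

UEdge : ℕ → ℕ → Set
UEdge a b = InS a × (b ≡ (a + 5) * (a + 5))

DEdge : ℕ → ℕ → Set
DEdge a b = InS b × (a ≡ b * b)

data Belt : ℕ → ℕ → ℕ → Set where
  one  : ∀ {x y z} → UEdge x y → DEdge y z → Belt 1 x z
  step : ∀ {i x y z w} → UEdge x y → DEdge y z → Belt i z w → Belt (suc i) x w

IsSquare : ℕ → Set
IsSquare n = Σ ℕ (λ m → n ≡ m * m)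

-- Squaring is injective, so every UD step of a belt adds exactly 5 and a belt of length i
-- from m² ends at n² = m² + 5i. For i ≤ 74 the gap n² − m² ≥ 2n − 1 forces n ≤ 185, and the
-- finitely many remaining pairs (m, n) are checked by evaluation. The extremal pairs are
-- n = m + 1, where 5 ∣ 2m + 1 forces m ≡ 2 and m² ≡ 4 (mod 5), giving (182, 183); and
-- n = m + 2, where 5 ∣ 4(m + 1) forces m ≡ 4 and m² ≡ 1 (mod 5), giving (89, 91).
module Submission where

open import Defs
open import Data.Nat using (ℕ; suc; _+_; _*_; _<_; _≤_; _%_; s≤s; z<s; _≟_; _≤?_)
open import Data.Nat.DivMod using ([m+kn]%n≡m%n)
open import Data.Nat.Properties
open import Data.Nat.Solver using (module +-*-Solver)
open import Data.Product using (_×_; _,_)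
open import Relation.Binary.PropositionalEquality
open import Relation.Nullary using (Dec)
open import Relation.Nullary.Decidable using (_×-dec_; _→-dec_; from-yes)

open +-*-Solver

m*m≤n*n⇒m≤n : ∀ {m n} → m * m ≤ n * n → m ≤ n
m*m≤n*n⇒m≤n mm≤nn = ≮⇒≥ (λ n<m → <⇒≱ (*-mono-< n<m n<m) mm≤nn)

m*m≡n*n⇒m≡n : ∀ {m n} → m * m ≡ n * n → m ≡ n
m*m≡n*n⇒m≡n eq = ≤-antisym (m*m≤n*n⇒m≤n (≤-reflexive eq)) (m*m≤n*n⇒m≤n (≤-reflexive (sym eq)))

m*m<n*n⇒m<n : ∀ {m n} → m * m < n * n → m < n
m*m<n*n⇒m<n mm<nn = ≰⇒> (λ n≤m → <⇒≱ mm<nn (*-mono-≤ n≤m n≤m))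

m<n⇒m*m+2n≤1+n*n : ∀ {m n} → m < n → m * m + 2 * n ≤ suc (n * n)
m<n⇒m*m+2n≤1+n*n {m} {suc p} (s≤s m≤p) = begin
  m * m + 2 * suc p  ≤⟨ +-monoˡ-≤ (2 * suc p) (*-mono-≤ m≤p m≤p) ⟩
  p * p + 2 * suc p  ≡⟨ solve 1 (λ p → p :* p :+ con 2 :* (con 1 :+ p)
                                  := con 1 :+ (con 1 :+ p) :* (con 1 :+ p)) refl p ⟩
  suc (suc p * suc p) ∎
  where open ≤-Reasoning

square-gap-bound : ∀ {m n k} → m < n → n * n ≤ m * m + k → 2 * n ≤ suc k
square-gap-bound {m} {n} {k} m<n nn≤mm+k = +-cancelˡ-≤ (m * m) (2 * n) (suc k) (begin
  m * m + 2 * n   ≤⟨ m<n⇒m*m+2n≤1+n*n m<n ⟩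
  suc (n * n)     ≤⟨ s≤s nn≤mm+k ⟩
  suc (m * m + k) ≡⟨ +-suc (m * m) k ⟨
  m * m + suc k   ∎)
  where open ≤-Reasoning

up-down-endpoint : ∀ {x y z} → UEdge x y → DEdge y z → z ≡ x + 5
up-down-endpoint (_ , y≡[x+5]²) (_ , y≡z²) = m*m≡n*n⇒m≡n (trans (sym y≡z²) y≡[x+5]²)

belt-endpoint : ∀ {i x z} → Belt i x z → z ≡ x + i * 5
belt-endpoint (one u d) = up-down-endpoint u d
belt-endpoint {suc i} {x} {w} (step {z = z} u d belt) = begin
  w             ≡⟨ belt-endpoint belt ⟩
  z + i * 5     ≡⟨ cong (_+ i * 5) (up-down-endpoint u d) ⟩
  x + 5 + i * 5 ≡⟨ +-assoc x 5 (i * 5) ⟩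
  x + suc i * 5 ∎
  where open ≡-Reasoning

belt-length-positive : ∀ {i x z} → Belt i x z → 0 < i
belt-length-positive (one _ _)    = z<s
belt-length-positive (step _ _ _) = z<s

EndpointBounds : ℕ → ℕ → Set
EndpointBounds x z = (x % 5 ≡ 1 → z ≤ 91 * 91) × (x % 5 ≡ 4 → z ≤ 183 * 183)

endpointBounds? : ∀ x z → Dec (EndpointBounds x z)
endpointBounds? x z = (x % 5 ≟ 1 →-dec z ≤? 91 * 91) ×-dec (x % 5 ≟ 4 →-dec z ≤? 183 * 183)

CloseSquaresBounded : ℕ → ℕ → Set
CloseSquaresBounded m n =
  n * n ≤ m * m + 370 → n * n % 5 ≡ m * m % 5 → EndpointBounds (m * m) (n * n)

closeSquaresBounded? : ∀ m n → Dec (CloseSquaresBounded m n)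
closeSquaresBounded? m n =
  n * n ≤? m * m + 370 →-dec n * n % 5 ≟ m * m % 5 →-dec endpointBounds? (m * m) (n * n)

close-squares-bounded : ∀ {n} → n < 186 → ∀ {m} → m < n → CloseSquaresBounded m n
close-squares-bounded =
  from-yes (allUpTo? (λ n → allUpTo? (λ m → closeSquaresBounded? m n) n) 186)

lemma11 : ∀ (i x z : ℕ) → Belt i x z → i + i < 150 → IsSquare x → IsSquare z →
              ((x % 5 ≡ 1 → z ≤ 91 * 91) × (x % 5 ≡ 4 → z ≤ 183 * 183))
lemma11 i x z belt 2i<150 (m , refl) (n , refl) =
  close-squares-bounded n<186 m<n nn≤mm+370 nn%5≡mm%5
  where
  nn≡mm+5i : n * n ≡ m * m + i * 5
  nn≡mm+5i = belt-endpoint belt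
  i≤74 : i ≤ 74
  i≤74 = ≮⇒≥ (λ 74<i → <⇒≱ 2i<150 (+-mono-≤ 74<i 74<i))
  nn≤mm+370 : n * n ≤ m * m + 370
  nn≤mm+370 = ≤-trans (≤-reflexive nn≡mm+5i) (+-monoʳ-≤ (m * m) (*-monoˡ-≤ 5 i≤74))
  m<n : m < n
  m<n = m*m<n*n⇒m<n (≤-trans (m<m+n (m * m) (*-monoˡ-< 5 (belt-length-positive belt)))
                             (≤-reflexive (sym nn≡mm+5i)))
  n<186 : n < 186
  n<186 = *-cancelˡ-< 2 n 186 (s≤s (square-gap-bound m<n nn≤mm+370))
  nn%5≡mm%5 : n * n % 5 ≡ m * m % 5
  nn%5≡mm%5 = trans (cong (_% 5) nn≡mm+5i) ([m+kn]%n≡m%n (m * m) i 5)
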